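{- Let $\Gamma$ be a neighborly graph. Suppose $V(\Gamma)=U\sqcup V$ is a partition such that $\vec e_u-\vec e_v\in\mathbb{Z}^{C_\Gamma}$ whenever $u,v$ lie in the same part, and $\vec e_u+\vec e_v\in\mathbb{Z}^{C_\Gamma}$ whenever they lie in different parts. Let \[\delta=\gcd\{|N[v]\cap U|-|N[v]\cap V| : v\in\Gamma\},\quad \kappa=\gcd\{|N[u]\cap N[v]\cap U|-|N[u]\cap N[v]\cap V| : u,v\in\Gamma,\ u\neq v\}.\] If $\delta$ and $\kappa$ are not both zero, then $\Gamma$ is $1/\mu$-RA with $\mu=\gcd(\delta,\kappa)$.
   Context: All graphs are finite and simple. $N[v]$ is the closed neighbourhood of $v$; $\vec e_v$ is the standard basis vector of $v$ and, for a vertex set $S$, $\vec S=\sum_{v\in S}\vec e_v$. The RA matrix $C_\Gamma$ of a graph on $m$ vertices has $m$ columns and rows $\vec{N[v]}$ for all vertices $v$ together with $\overrightarrow{N[u]\cap N[v]}$ for all pairs $u,v$; $\mathbb{Z}^{C_\Gamma}$ denotes the $\mathbb{Z}$-span of its rows. $\Gamma$ is neighborly if for every edge $u-v$, at least one of $\vec e_u+\vec e_v$, $\vec e_u-\vec e_v$ lies in $\mathbb{Z}^{C_\Gamma}$. For $k\ge1$, $\Gamma$ is $1/k$-RA if for every ordering of the columns of $C_\Gamma$, the diagonal of the Hermite normal form of $C_\Gamma$ is $(1,\dots,1,k)$ ($m-1$ ones). -}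

module Defs where

open import Data.Nat as ℕ using (ℕ; zero; suc)
open import Data.Nat.GCD using (gcd)
open import Data.Integer as ℤ using (ℤ; +_; _+_; _*_; _-_; ∣_∣; _≤_; _<_)
open import Data.Bool using (Bool; true; false; _∧_; _∨_; not; if_then_else_)
open import Data.Fin using (Fin; toℕ; _≟_)
open import Data.Fin.Permutation using (Permutation′; _⟨$⟩ʳ_)
open import Data.Product using (Σ; ∃; _×_; _,_)
open import Data.Sum using (_⊎_)
open import Relation.Binary.PropositionalEquality using (_≡_; _≢_)
open import Relation.Nullary.Decidable using (⌊_⌋)

record Graph (m : ℕ) : Set where
  field
    adj   : Fin m → Fin m → Bool
    sym   : ∀ u v → adj u v ≡ adj v u
    irrefl : ∀ v → adj v v ≡ false
open Graph public

sumFin : ∀ {n} → (Fin n → ℤ) → ℤ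
sumFin {zero}  f = + 0
sumFin {suc n} f = f Data.Fin.zero + sumFin (λ i → f (Data.Fin.suc i))

countFin : ∀ {n} → (Fin n → Bool) → ℕ
countFin {zero}  p = 0
countFin {suc n} p = (if p Data.Fin.zero then 1 else 0) ℕ.+ countFin (λ i → p (Data.Fin.suc i))

inN : ∀ {m} → Graph m → Fin m → Fin m → Bool
inN G v w = ⌊ v ≟ w ⌋ ∨ adj G v w

b2z : Bool → ℤ
b2z true  = + 1
b2z false = + 0

Vecℤ : ℕ → Set
Vecℤ m = Fin m → ℤ

rowN : ∀ {m} → Graph m → Fin m → Vecℤ m
rowN G v w = b2z (inN G v w)

rowNN : ∀ {m} → Graph m → Fin m → Fin m → Vecℤ m
rowNN G u v w = b2z (inN G u w ∧ inN G v w)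

-- y lies in the ℤ-span of the rows of the RA matrix C_Γ.
-- (Rows for all ordered pairs (u,v) are allowed; pairs u = v and repeated
--  pairs do not change the span.)
InSpanC : ∀ {m} → Graph m → Vecℤ m → Set
InSpanC {m} G y =
  Σ (Fin m → ℤ) λ c → Σ (Fin m → Fin m → ℤ) λ d →
    ∀ w → y w ≡ sumFin (λ v → c v * rowN G v w)
               + sumFin (λ u → sumFin (λ v → d u v * rowNN G u v w))

e : ∀ {m} → Fin m → Vecℤ m
e v w = b2z ⌊ v ≟ w ⌋

_⊕_ _⊖_ : ∀ {m} → Vecℤ m → Vecℤ m → Vecℤ m
(x ⊕ y) w = x w + y w
(x ⊖ y) w = x w - y w

Neighborly : ∀ {m} → Graph m → Set
Neighborly {m} G = ∀ u v → adj G u v ≡ true →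
  InSpanC G (e u ⊕ e v) ⊎ InSpanC G (e u ⊖ e v)

InRowSpan : ∀ {m} → (Fin m → Fin m → ℤ) → Vecℤ m → Set
InRowSpan {m} H y = Σ (Fin m → ℤ) λ a → ∀ j → y j ≡ sumFin (λ i → a i * H i j)

-- H (m×m) is the Hermite normal form (nonzero rows) of C_Γ with columns
-- reordered by σ: column j of the reordered matrix is column σ(j) of C_Γ.
IsHNF : ∀ {m} → Graph m → Permutation′ m → (Fin m → Fin m → ℤ) → Set
IsHNF {m} G σ H =
    (∀ i j → toℕ j ℕ.< toℕ i → H i j ≡ + 0)
  × (∀ i → + 0 < H i i)
  × (∀ i j → toℕ i ℕ.< toℕ j → (+ 0 ≤ H i j) × (H i j < H j j))
  × (∀ (y : Vecℤ m) →
       (InRowSpan H y → Σ (Vecℤ m) λ x → InSpanC G x × (∀ j → y j ≡ x (σ ⟨$⟩ʳ j)))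
     × ((Σ (Vecℤ m) λ x → InSpanC G x × (∀ j → y j ≡ x (σ ⟨$⟩ʳ j))) → InRowSpan H y))

DiagOnesThen : ∀ {m} → (Fin m → Fin m → ℤ) → ℕ → Set
DiagOnesThen {m} H k = ∀ i →
  (suc (toℕ i) ≡ m → H i i ≡ + k) × (suc (toℕ i) ≢ m → H i i ≡ + 1)

IsRA : ∀ {m} → Graph m → ℕ → Set
IsRA {m} G k = (1 ℕ.≤ k) ×
  (∀ (σ : Permutation′ m) → Σ (Fin m → Fin m → ℤ) λ H → IsHNF G σ H × DiagOnesThen H k)

-- |S ∩ U| - |S ∩ V| where U = {side = true}, V = {side = false}.
signedCount : ∀ {m} → (Fin m → Bool) → (Fin m → Bool) → ℤ
signedCount side S =
  + countFin (λ w → S w ∧ side w) - + countFin (λ w → S w ∧ not (side w))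

-- gcd over a family of integers (gcd of absolute values; empty gcd = 0).
gcdFin : ∀ {n} → (Fin n → ℤ) → ℕ
gcdFin {zero}  f = 0
gcdFin {suc n} f = gcd ∣ f Data.Fin.zero ∣ (gcdFin (λ i → f (Data.Fin.suc i)))

gcdPairs : ∀ {m} → (Fin m → Fin m → ℤ) → ℕ
gcdPairs f = gcdFin (λ u → + gcdFin (λ v → if ⌊ u ≟ v ⌋ then + 0 else f u v))

δ : ∀ {m} → Graph m → (Fin m → Bool) → ℕ
δ G side = gcdFin (λ v → signedCount side (inN G v))

κ : ∀ {m} → Graph m → (Fin m → Bool) → ℕ
κ G side = gcdPairs (λ u v → signedCount side (λ w → inN G u w ∧ inN G v w))

module Submission where

-- Let s be the sign vector of the partition (+1 on U, -1 on V) and φ x = s · x.  The φ-value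
-- of a row of C_Γ is a signed count, so φ maps the row lattice L into μℤ, and by Bézout it
-- attains μ.  The partition hypotheses say e_w - s_w s_b e_b ∈ L for all w, b, hence
-- x - φ(x) s_b e_b ∈ L for every x; applied to a vector with φ = μ this gives μ e_b ∈ L,
-- so L = {x : μ ∣ φ x}.  After any reordering of the columns this lattice has the Hermite
-- basis e_i + c_i e_last (c_i the residue of -s_i s_last mod μ) and μ e_last, whose diagonal
-- is (1,…,1,μ).

open import Defs hiding (sym)
open import Data.Nat as ℕ using (ℕ; zero; suc; z≤n; s≤s)
open import Data.Nat.GCD using (gcd; gcd[m,n]∣m; gcd[m,n]∣n; gcd-GCD; gcd[m,n]≡0⇒m≡0; gcd[m,n]≡0⇒n≡0; module Bézout)
import Data.Nat.Properties as ℕ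
import Data.Nat.Divisibility as ℕ
open import Data.Integer as ℤ using (ℤ; +_; -[1+_]; -_; _+_; _-_; _*_; ∣_∣; 0ℤ; 1ℤ; -1ℤ; +≤+; +<+; _%ℕ_; _/ℕ_)
import Data.Integer.Properties as ℤ
open import Data.Integer.DivMod using (a≡a%ℕn+[a/ℕn]*n; n%ℕd<d)
open import Data.Integer.Divisibility.Signed
  using (_∣_; divides; ∣ᵤ⇒∣; ∣-trans; ∣m∣n⇒∣m+n; ∣n⇒∣m*n; ∣m+n∣n⇒∣m)
open import Data.Integer.Tactic.RingSolver using (solve-∀)
open import Data.Fin.Patterns using (0F)
open import Data.Fin as Fin using (Fin; toℕ; fromℕ; _≟_; _<_)
import Data.Fin.Properties as Fin
open import Data.Fin.Permutation using (Permutation′; _⟨$⟩ʳ_; _⟨$⟩ˡ_; inverseˡ)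
open import Data.Bool as Bool using (Bool; true; false; not; _∧_; if_then_else_)
open import Data.Bool.Properties using (∧-idem)
open import Data.Product using (Σ; ∃; _×_; _,_)
open import Data.Empty using (⊥-elim)
open import Function using (_∘_)
open import Relation.Nullary using (¬_; Dec; yes; no)
open import Relation.Nullary.Decidable using (⌊_⌋; isYes≗does; dec-true; dec-false)
open import Relation.Binary.PropositionalEquality
  using (_≡_; _≢_; _≗_; refl; sym; trans; cong; cong₂; subst; subst₂; module ≡-Reasoning)

open import Algebra.Properties.CommutativeSemigroup ℤ.*-commutativeSemigroup using (x∙yz≈y∙xz; xy∙z≈xz∙y)
open import Algebra.Properties.CommutativeSemigroup ℤ.+-commutativeSemigroup using () renaming (interchange to +-interchange)
open import Algebra.Properties.Semiring.Sum ℤ.+-*-semiring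
  using (sum; ∑-distrib-+; *-distribˡ-sum; sum-permute)

sumFin≡sum : ∀ {n} (f : Fin n → ℤ) → sumFin f ≡ sum f
sumFin≡sum {zero}  f = refl
sumFin≡sum {suc n} f = cong (_+_ (f 0F)) (sumFin≡sum (f ∘ Fin.suc))

sumFin-cong : ∀ {n} {f g : Fin n → ℤ} → f ≗ g → sumFin f ≡ sumFin g
sumFin-cong {zero}  f≗g = refl
sumFin-cong {suc n} f≗g = cong₂ _+_ (f≗g 0F) (sumFin-cong (f≗g ∘ Fin.suc))

sumFin-+ : ∀ {n} (f g : Fin n → ℤ) → sumFin (λ i → f i + g i) ≡ sumFin f + sumFin g
sumFin-+ f g = begin
  sumFin (λ i → f i + g i)  ≡⟨ sumFin≡sum (λ i → f i + g i) ⟩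
  sum (λ i → f i + g i)     ≡⟨ ∑-distrib-+ f g ⟩
  sum f + sum g             ≡⟨ cong₂ _+_ (sumFin≡sum f) (sumFin≡sum g) ⟨
  sumFin f + sumFin g       ∎
  where open ≡-Reasoning

sumFin-*ˡ : ∀ {n} (t : ℤ) (f : Fin n → ℤ) → sumFin (λ i → t * f i) ≡ t * sumFin f
sumFin-*ˡ t f = begin
  sumFin (λ i → t * f i)  ≡⟨ sumFin≡sum (λ i → t * f i) ⟩
  sum (λ i → t * f i)     ≡⟨ *-distribˡ-sum t f ⟨
  t * sum f               ≡⟨ cong (t *_) (sumFin≡sum f) ⟨
  t * sumFin f            ∎
  where open ≡-Reasoning

sumFin-zero : ∀ {n} → sumFin {n} (λ _ → 0ℤ) ≡ 0ℤ
sumFin-zero {zero}  = refl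
sumFin-zero {suc n} = trans (ℤ.+-identityˡ _) (sumFin-zero {n})

sumFin-linearˡ-+ : ∀ {n} (a b f : Fin n → ℤ) →
  sumFin (λ i → (a i + b i) * f i) ≡ sumFin (λ i → a i * f i) + sumFin (λ i → b i * f i)
sumFin-linearˡ-+ a b f = trans (sumFin-cong (λ i → ℤ.*-distribʳ-+ (f i) (a i) (b i)))
                               (sumFin-+ (λ i → a i * f i) (λ i → b i * f i))

sumFin-linearˡ-* : ∀ {n} (r : ℤ) (a f : Fin n → ℤ) →
  sumFin (λ i → (r * a i) * f i) ≡ r * sumFin (λ i → a i * f i)
sumFin-linearˡ-* r a f = trans (sumFin-cong (λ i → ℤ.*-assoc r (a i) (f i)))
                               (sumFin-*ˡ r (λ i → a i * f i))

sumFin-permute : ∀ {n} (f : Fin n → ℤ) (π : Permutation′ n) → sumFin f ≡ sumFin (f ∘ (π ⟨$⟩ʳ_))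
sumFin-permute f π = begin
  sumFin f                ≡⟨ sumFin≡sum f ⟩
  sum f                   ≡⟨ sum-permute f π ⟩
  sum (f ∘ (π ⟨$⟩ʳ_))      ≡⟨ sumFin≡sum (f ∘ (π ⟨$⟩ʳ_)) ⟨
  sumFin (f ∘ (π ⟨$⟩ʳ_))   ∎
  where open ≡-Reasoning

≟-≡ : ∀ {n} {a b : Fin n} → a ≡ b → ⌊ a ≟ b ⌋ ≡ true
≟-≡ {a = a} {b} a≡b = trans (isYes≗does (a ≟ b)) (dec-true (a ≟ b) a≡b)

≟-≢ : ∀ {n} {a b : Fin n} → a ≢ b → ⌊ a ≟ b ⌋ ≡ false
≟-≢ {a = a} {b} a≢b = trans (isYes≗does (a ≟ b)) (dec-false (a ≟ b) a≢b)

e-≡ : ∀ {n} {a b : Fin n} → a ≡ b → e a b ≡ 1ℤ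
e-≡ a≡b = cong b2z (≟-≡ a≡b)

e-≢ : ∀ {n} {a b : Fin n} → a ≢ b → e a b ≡ 0ℤ
e-≢ a≢b = cong b2z (≟-≢ a≢b)

e-sym : ∀ {n} (a b : Fin n) → e a b ≡ e b a
e-sym a b = by-cases (a ≟ b)
  where
  by-cases : Dec (a ≡ b) → e a b ≡ e b a
  by-cases (yes a≡b) = trans (e-≡ a≡b) (sym (e-≡ (sym a≡b)))
  by-cases (no a≢b)  = trans (e-≢ a≢b) (sym (e-≢ (a≢b ∘ sym)))

e-suc : ∀ {n} (a b : Fin n) → e (Fin.suc a) (Fin.suc b) ≡ e a b
e-suc a b = by-cases (a ≟ b)
  where
  by-cases : Dec (a ≡ b) → e (Fin.suc a) (Fin.suc b) ≡ e a b
  by-cases (yes a≡b) = trans (e-≡ (cong Fin.suc a≡b)) (sym (e-≡ a≡b))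
  by-cases (no a≢b)  = trans (e-≢ (a≢b ∘ Fin.suc-injective)) (sym (e-≢ a≢b))

sumFin-δ : ∀ {n} (f : Fin n → ℤ) (a : Fin n) → sumFin (λ i → f i * e i a) ≡ f a
sumFin-δ {suc n} f 0F = begin
  f 0F * e {suc n} 0F 0F + sumFin (λ i → f (Fin.suc i) * e (Fin.suc i) 0F)
    ≡⟨ cong₂ _+_ (cong (f 0F *_) (e-≡ {suc n} {0F} refl)) (sumFin-cong off-diagonal) ⟩
  f 0F * 1ℤ + sumFin {n} (λ _ → 0ℤ)
    ≡⟨ cong₂ _+_ (ℤ.*-identityʳ (f 0F)) (sumFin-zero {n}) ⟩
  f 0F + 0ℤ
    ≡⟨ ℤ.+-identityʳ (f 0F) ⟩
  f 0F ∎
  where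
  open ≡-Reasoning
  off-diagonal : ∀ i → f (Fin.suc i) * e (Fin.suc i) 0F ≡ 0ℤ
  off-diagonal i = trans (cong (f (Fin.suc i) *_) (e-≢ {a = Fin.suc i} {0F} λ ())) (ℤ.*-zeroʳ (f (Fin.suc i)))
sumFin-δ {suc n} f (Fin.suc a) = begin
  f 0F * e 0F (Fin.suc a) + sumFin (λ i → f (Fin.suc i) * e (Fin.suc i) (Fin.suc a))
    ≡⟨ cong₂ _+_ (trans (cong (f 0F *_) (e-≢ {a = 0F} {Fin.suc a} λ ())) (ℤ.*-zeroʳ (f 0F)))
                 (sumFin-cong (λ i → cong (f (Fin.suc i) *_) (e-suc i a))) ⟩
  0ℤ + sumFin (λ i → f (Fin.suc i) * e i a)
    ≡⟨ ℤ.+-identityˡ _ ⟩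
  sumFin (λ i → f (Fin.suc i) * e i a)
    ≡⟨ sumFin-δ (f ∘ Fin.suc) a ⟩
  f (Fin.suc a) ∎
  where open ≡-Reasoning

dot : ∀ {n} → Vecℤ n → Vecℤ n → ℤ
dot x y = sumFin (λ i → x i * y i)

dot-comm : ∀ {n} (x y : Vecℤ n) → dot x y ≡ dot y x
dot-comm x y = sumFin-cong (λ i → ℤ.*-comm (x i) (y i))

dot-congʳ : ∀ {n} (x : Vecℤ n) {y z : Vecℤ n} → y ≗ z → dot x y ≡ dot x z
dot-congʳ x y≗z = sumFin-cong (λ i → cong (x i *_) (y≗z i))

dot-zeroʳ : ∀ {n} (x : Vecℤ n) → dot x (λ _ → 0ℤ) ≡ 0ℤ
dot-zeroʳ {n} x = trans (sumFin-cong (λ i → ℤ.*-zeroʳ (x i))) (sumFin-zero {n})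

dot-⊕ʳ : ∀ {n} (x y z : Vecℤ n) → dot x (y ⊕ z) ≡ dot x y + dot x z
dot-⊕ʳ x y z = trans (sumFin-cong (λ i → ℤ.*-distribˡ-+ (x i) (y i) (z i)))
                     (sumFin-+ (λ i → x i * y i) (λ i → x i * z i))

dot-*ʳ : ∀ {n} (x y : Vecℤ n) (r : ℤ) → dot x (λ i → r * y i) ≡ r * dot x y
dot-*ʳ x y r = trans (sumFin-cong (λ i → x∙yz≈y∙xz (x i) r (y i)))
                     (sumFin-*ˡ r (λ i → x i * y i))

dot-eʳ : ∀ {n} (x : Vecℤ n) (a : Fin n) → dot x (e a) ≡ x a
dot-eʳ x a = trans (dot-congʳ x (e-sym a)) (sumFin-δ x a)

dot-∣ : ∀ {n} {k : ℤ} (y u : Vecℤ n) → (∀ i → k ∣ u i) → k ∣ dot y u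
dot-∣ {zero}  y u k∣u = divides 0ℤ refl
dot-∣ {suc n} y u k∣u =
  ∣m∣n⇒∣m+n (∣n⇒∣m*n (y 0F) (k∣u 0F)) (dot-∣ (y ∘ Fin.suc) (u ∘ Fin.suc) (k∣u ∘ Fin.suc))

dot-permute : ∀ {n} (π : Permutation′ n) (x y : Vecℤ n) → dot x y ≡ dot (x ∘ (π ⟨$⟩ʳ_)) (y ∘ (π ⟨$⟩ʳ_))
dot-permute π x y = sumFin-permute (λ i → x i * y i) π

record IsSubmodule {m} (P : Vecℤ m → Set) : Set where
  field
    resp-≗   : ∀ {x y} → x ≗ y → P x → P y
    0∈       : P (λ _ → 0ℤ)
    ⊕-closed : ∀ {x y} → P x → P y → P (x ⊕ y)
    *-closed : ∀ r {x} → P x → P (λ w → r * x w)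

  ⊖-closed : ∀ {x y} → P x → P y → P (x ⊖ y)
  ⊖-closed {x} {y} Px Py =
    resp-≗ (λ w → cong (_+_ (x w)) (ℤ.-1*i≡-i (y w))) (⊕-closed Px (*-closed -1ℤ Py))

  sum-closed : ∀ {n} (f : Fin n → Vecℤ m) → (∀ i → P (f i)) → P (λ w → sumFin (λ i → f i w))
  sum-closed {zero}  f Pf = 0∈
  sum-closed {suc n} f Pf = ⊕-closed (Pf 0F) (sum-closed (f ∘ Fin.suc) (Pf ∘ Fin.suc))

  linComb-closed : ∀ {n} (a : Fin n → ℤ) (f : Fin n → Vecℤ m) → (∀ i → P (f i)) →
                   P (λ w → sumFin (λ i → a i * f i w))
  linComb-closed a f Pf = sum-closed (λ i w → a i * f i w) (λ i → *-closed (a i) (Pf i))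

divisible-isSubmodule : ∀ {m} (k : ℤ) (t : Vecℤ m) → IsSubmodule (λ x → k ∣ dot t x)
divisible-isSubmodule k t = record
  { resp-≗   = λ {x} x≗y k∣tx → subst (k ∣_) (dot-congʳ t x≗y) k∣tx
  ; 0∈       = subst (k ∣_) (sym (dot-zeroʳ t)) (divides 0ℤ refl)
  ; ⊕-closed = λ {x} {y} k∣tx k∣ty → subst (k ∣_) (sym (dot-⊕ʳ t x y)) (∣m∣n⇒∣m+n k∣tx k∣ty)
  ; *-closed = λ r {x} k∣tx → subst (k ∣_) (sym (dot-*ʳ t x r)) (∣n⇒∣m*n r k∣tx)
  }

module _ {m} (G : Graph m) where

  private
    spanned : (Fin m → ℤ) → (Fin m → Fin m → ℤ) → Vecℤ m
    spanned c d w = sumFin (λ v → c v * rowN G v w) + sumFin (λ u → sumFin (λ v → d u v * rowNN G u v w))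

    spanned-zero : ∀ w → spanned (λ _ → 0ℤ) (λ _ _ → 0ℤ) w ≡ 0ℤ
    spanned-zero w =
      cong₂ _+_ (sumFin-zero {m}) (trans (sumFin-cong {m} (λ _ → sumFin-zero {m})) (sumFin-zero {m}))

    spanned-⊕ : ∀ c₁ d₁ c₂ d₂ w →
                spanned (c₁ ⊕ c₂) (λ u → d₁ u ⊕ d₂ u) w ≡ spanned c₁ d₁ w + spanned c₂ d₂ w
    spanned-⊕ c₁ d₁ c₂ d₂ w = begin
      spanned (c₁ ⊕ c₂) (λ u → d₁ u ⊕ d₂ u) w
        ≡⟨ cong₂ _+_ (sumFin-linearˡ-+ c₁ c₂ (λ v → rowN G v w))
                     (trans (sumFin-cong (λ u → sumFin-linearˡ-+ (d₁ u) (d₂ u) (λ v → rowNN G u v w)))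
                            (sumFin-+ (λ u → pairs d₁ u) (λ u → pairs d₂ u))) ⟩
      (singles c₁ + singles c₂) + (sumFin (pairs d₁) + sumFin (pairs d₂))
        ≡⟨ +-interchange (singles c₁) (singles c₂) (sumFin (pairs d₁)) (sumFin (pairs d₂)) ⟩
      spanned c₁ d₁ w + spanned c₂ d₂ w ∎
      where
      open ≡-Reasoning
      singles : (Fin m → ℤ) → ℤ
      singles c = sumFin (λ v → c v * rowN G v w)
      pairs : (Fin m → Fin m → ℤ) → Fin m → ℤ
      pairs d u = sumFin (λ v → d u v * rowNN G u v w)

    spanned-* : ∀ r c d w → spanned (λ v → r * c v) (λ u v → r * d u v) w ≡ r * spanned c d w
    spanned-* r c d w = begin
      spanned (λ v → r * c v) (λ u v → r * d u v) w
        ≡⟨ cong₂ _+_ (sumFin-linearˡ-* r c (λ v → rowN G v w))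
                     (trans (sumFin-cong (λ u → sumFin-linearˡ-* r (d u) (λ v → rowNN G u v w)))
                            (sumFin-*ˡ r (λ u → sumFin (λ v → d u v * rowNN G u v w)))) ⟩
      r * sumFin (λ v → c v * rowN G v w) + r * sumFin (λ u → sumFin (λ v → d u v * rowNN G u v w))
        ≡⟨ ℤ.*-distribˡ-+ r _ _ ⟨
      r * spanned c d w ∎
      where open ≡-Reasoning

  span-isSubmodule : IsSubmodule (InSpanC G)
  span-isSubmodule = record
    { resp-≗   = λ { x≗y (c , d , x≗cd) → c , d , λ w → trans (sym (x≗y w)) (x≗cd w) }
    ; 0∈       = (λ _ → 0ℤ) , (λ _ _ → 0ℤ) , λ w → sym (spanned-zero w)
    ; ⊕-closed = λ { (c₁ , d₁ , x≗) (c₂ , d₂ , y≗) →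
                   c₁ ⊕ c₂ , (λ u → d₁ u ⊕ d₂ u) , λ w →
                     trans (cong₂ _+_ (x≗ w) (y≗ w)) (sym (spanned-⊕ c₁ d₁ c₂ d₂ w)) }
    ; *-closed = λ { r (c , d , x≗) →
                   (λ v → r * c v) , (λ u v → r * d u v) , λ w →
                     trans (cong (r *_) (x≗ w)) (sym (spanned-* r c d w)) }
    }

  rowN∈span : ∀ v → InSpanC G (rowN G v)
  rowN∈span v = (λ v′ → e v′ v) , (λ _ _ → 0ℤ) , λ w → sym (begin
    sumFin (λ v′ → e v′ v * rowN G v′ w) + sumFin {m} (λ _ → sumFin {m} (λ _ → 0ℤ))
      ≡⟨ cong₂ _+_ (sumFin-cong (λ v′ → ℤ.*-comm (e v′ v) (rowN G v′ w)))
                   (trans (sumFin-cong {m} (λ _ → sumFin-zero {m})) (sumFin-zero {m})) ⟩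
    sumFin (λ v′ → rowN G v′ w * e v′ v) + 0ℤ
      ≡⟨ ℤ.+-identityʳ _ ⟩
    sumFin (λ v′ → rowN G v′ w * e v′ v)
      ≡⟨ sumFin-δ (λ v′ → rowN G v′ w) v ⟩
    rowN G v w ∎)
    where open ≡-Reasoning

  rowNN∈span : ∀ u v → InSpanC G (rowNN G u v)
  rowNN∈span u v = (λ _ → 0ℤ) , (λ u′ v′ → e u′ u * e v′ v) , λ w → sym (begin
    sumFin {m} (λ _ → 0ℤ) + sumFin (λ u′ → sumFin (λ v′ → (e u′ u * e v′ v) * rowNN G u′ v′ w))
      ≡⟨ cong₂ _+_ (sumFin-zero {m})
                   (sumFin-cong (λ u′ → sumFin-cong (λ v′ → xy∙z≈xz∙y (e u′ u) (e v′ v) _))) ⟩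
    0ℤ + sumFin (λ u′ → sumFin (λ v′ → (e u′ u * rowNN G u′ v′ w) * e v′ v))
      ≡⟨ ℤ.+-identityˡ _ ⟩
    sumFin (λ u′ → sumFin (λ v′ → (e u′ u * rowNN G u′ v′ w) * e v′ v))
      ≡⟨ sumFin-cong (λ u′ → trans (sumFin-δ (λ v′ → e u′ u * rowNN G u′ v′ w) v)
                                   (ℤ.*-comm (e u′ u) (rowNN G u′ v w))) ⟩
    sumFin (λ u′ → rowNN G u′ v w * e u′ u)
      ≡⟨ sumFin-δ (λ u′ → rowNN G u′ v w) u ⟩
    rowNN G u v w ∎)
    where open ≡-Reasoning

  span-least : ∀ {P} → IsSubmodule P → (∀ v → P (rowN G v)) → (∀ u v → P (rowNN G u v)) →
               ∀ {x} → InSpanC G x → P x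
  span-least P-sub P-rowN P-rowNN (c , d , x≗cd) =
    resp-≗ (sym ∘ x≗cd)
      (⊕-closed (linComb-closed c (rowN G) P-rowN)
                (sum-closed _ (λ u → linComb-closed (d u) (rowNN G u) (P-rowNN u))))
    where open IsSubmodule P-sub

bézout-combination : ∀ {g p q a b : ℕ} → g ℕ.+ q ℕ.* b ≡ p ℕ.* a → + p * + a + - + q * + b ≡ + g
bézout-combination {g} {p} {q} {a} {b} eq = begin
  + p * + a + - + q * + b            ≡⟨ cong (λ z → z + - + q * + b) (ℤ.pos-* p a) ⟨
  + (p ℕ.* a) + - + q * + b          ≡⟨ cong (λ z → + z + - + q * + b) eq ⟨
  + (g ℕ.+ q ℕ.* b) + - + q * + b    ≡⟨ cong (λ z → z + - + q * + b)
                                              (trans (ℤ.pos-+ g (q ℕ.* b)) (cong (_+_ (+ g)) (ℤ.pos-* q b))) ⟩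
  + g + + q * + b + - + q * + b      ≡⟨ cancel (+ g) (+ q) (+ b) ⟩
  + g                                ∎
  where
  open ≡-Reasoning
  cancel : ∀ G Q B → G + Q * B + - Q * B ≡ G
  cancel = solve-∀

record IsIdeal (I : ℤ → Set) : Set where
  field
    0∈       : I 0ℤ
    +-closed : ∀ {a b} → I a → I b → I (a + b)
    *-closed : ∀ r {a} → I a → I (r * a)

  ∣∣-closed : ∀ {a} → I a → I (+ ∣ a ∣)
  ∣∣-closed {+ n}      Ia = Ia
  ∣∣-closed { -[1+ n ]} Ia = subst I (ℤ.-1*i≡-i -[1+ n ]) (*-closed -1ℤ Ia)

  gcd-closed : ∀ {a b} → I (+ a) → I (+ b) → I (+ gcd a b)
  gcd-closed {a} {b} Ia Ib with Bézout.identity (gcd-GCD a b)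
  ... | Bézout.+- x y eq = subst I (bézout-combination {gcd a b} {x} {y} {a} {b} eq)
                                   (+-closed (*-closed (+ x) Ia) (*-closed (- + y) Ib))
  ... | Bézout.-+ x y eq = subst I (bézout-combination {gcd a b} {y} {x} {b} {a} eq)
                                   (+-closed (*-closed (+ y) Ib) (*-closed (- + x) Ia))

  gcdFin-closed : ∀ {n} (f : Fin n → ℤ) → (∀ i → I (f i)) → I (+ gcdFin f)
  gcdFin-closed {zero}  f If = 0∈
  gcdFin-closed {suc n} f If = gcd-closed (∣∣-closed (If 0F)) (gcdFin-closed (f ∘ Fin.suc) (If ∘ Fin.suc))

  gcdPairs-closed : ∀ {n} (f : Fin n → Fin n → ℤ) → (∀ u v → I (f u v)) → I (+ gcdPairs f)
  gcdPairs-closed f If = gcdFin-closed _ (λ u → gcdFin-closed _ (λ v → off-diagonal {u} {v} ⌊ u ≟ v ⌋))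
    where
    off-diagonal : ∀ {u v} b → I (if b then 0ℤ else f u v)
    off-diagonal true  = 0∈
    off-diagonal false = If _ _

image-isIdeal : ∀ {m} {P : Vecℤ m → Set} → IsSubmodule P → (t : Vecℤ m) →
                IsIdeal (λ a → ∃ λ x → P x × dot t x ≡ a)
image-isIdeal P-sub t = record
  { 0∈       = (λ _ → 0ℤ) , 0∈ , dot-zeroʳ t
  ; +-closed = λ { (x , Px , refl) (y , Py , refl) → x ⊕ y , ⊕-closed Px Py , dot-⊕ʳ t x y }
  ; *-closed = λ { r (x , Px , refl) → (λ w → r * x w) , *-closed r Px , dot-*ʳ t x r }
  }
  where open IsSubmodule P-sub

gcdFin-∣ : ∀ {n} (f : Fin n → ℤ) i → + gcdFin f ∣ f i
gcdFin-∣ f i = ∣ᵤ⇒∣ (gcdFin-∣ᵤ f i)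
  where
  gcdFin-∣ᵤ : ∀ {n} (f : Fin n → ℤ) i → gcdFin f ℕ.∣ ∣ f i ∣
  gcdFin-∣ᵤ f 0F          = gcd[m,n]∣m ∣ f 0F ∣ (gcdFin (f ∘ Fin.suc))
  gcdFin-∣ᵤ f (Fin.suc i) =
    ℕ.∣-trans (gcd[m,n]∣n ∣ f 0F ∣ (gcdFin (f ∘ Fin.suc))) (gcdFin-∣ᵤ (f ∘ Fin.suc) i)

gcdPairs-∣ : ∀ {n} (f : Fin n → Fin n → ℤ) {u v} → u ≢ v → + gcdPairs f ∣ f u v
gcdPairs-∣ f {u} {v} u≢v =
  ∣-trans (gcdFin-∣ _ u)
          (subst (λ b → + gcdFin (λ v′ → if ⌊ u ≟ v′ ⌋ then 0ℤ else f u v′) ∣ (if b then 0ℤ else f u v))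
                 (≟-≢ u≢v) (gcdFin-∣ _ v))

sideSign : Bool → ℤ
sideSign true  = 1ℤ
sideSign false = -1ℤ

sideSign-sq : ∀ a → sideSign a * sideSign a ≡ 1ℤ
sideSign-sq true  = refl
sideSign-sq false = refl

sideSign-≡ : ∀ {a b} → a ≡ b → sideSign a * sideSign b ≡ 1ℤ
sideSign-≡ {a} refl = sideSign-sq a

sideSign-≢ : ∀ {a b} → a ≢ b → sideSign a * sideSign b ≡ -1ℤ
sideSign-≢ {true}  {true}  a≢b = ⊥-elim (a≢b refl)
sideSign-≢ {true}  {false} _   = refl
sideSign-≢ {false} {true}  _   = refl
sideSign-≢ {false} {false} a≢b = ⊥-elim (a≢b refl)

dot-sideSign : ∀ {n} (side S : Fin n → Bool) → dot (sideSign ∘ side) (b2z ∘ S) ≡ signedCount side S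
dot-sideSign {zero}  side S = refl
dot-sideSign {suc n} side S =
  trans (cong₂ _+_ (term (side 0F) (S 0F)) (dot-sideSign (side ∘ Fin.suc) (S ∘ Fin.suc)))
        (regroup (indicator (S 0F ∧ side 0F)) (indicator (S 0F ∧ not (side 0F))) _ _)
  where
  indicator : Bool → ℕ
  indicator b = if b then 1 else 0
  term : ∀ s b → sideSign s * b2z b ≡ + indicator (b ∧ s) - + indicator (b ∧ not s)
  term true  true  = refl
  term true  false = refl
  term false true  = refl
  term false false = refl
  regroup : ∀ a b c d → + a - + b + (+ c - + d) ≡ + (a ℕ.+ c) - + (b ℕ.+ d)
  regroup a b c d = trans (interchange (+ a) (+ b) (+ c) (+ d))
                          (sym (cong₂ _-_ (ℤ.pos-+ a c) (ℤ.pos-+ b d)))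
    where
    interchange : ∀ A B C D → A - B + (C - D) ≡ (A + C) - (B + D)
    interchange = solve-∀

module SignedSpan {m} (G : Graph m) (side : Fin m → Bool) where

  s : Vecℤ m
  s = sideSign ∘ side

  μ : ℕ
  μ = gcd (δ G side) (κ G side)

  dot-rowN : ∀ v → dot s (rowN G v) ≡ signedCount side (inN G v)
  dot-rowN v = dot-sideSign side (inN G v)

  dot-rowNN : ∀ u v → dot s (rowNN G u v) ≡ signedCount side (λ w → inN G u w ∧ inN G v w)
  dot-rowNN u v = dot-sideSign side (λ w → inN G u w ∧ inN G v w)

  μ∣dot-rowN : ∀ v → + μ ∣ dot s (rowN G v)
  μ∣dot-rowN v = subst (+ μ ∣_) (sym (dot-rowN v))
    (∣-trans (∣ᵤ⇒∣ (gcd[m,n]∣m (δ G side) (κ G side))) (gcdFin-∣ _ v))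

  μ∣dot-rowNN : ∀ u v → + μ ∣ dot s (rowNN G u v)
  μ∣dot-rowNN u v = by-cases (u ≟ v)
    where
    by-cases : Dec (u ≡ v) → + μ ∣ dot s (rowNN G u v)
    by-cases (yes refl) = subst (+ μ ∣_) (dot-congʳ s (λ w → cong b2z (sym (∧-idem (inN G u w)))))
                                (μ∣dot-rowN u)
    by-cases (no u≢v)   = subst (+ μ ∣_) (sym (dot-rowNN u v))
      (∣-trans (∣ᵤ⇒∣ (gcd[m,n]∣n (δ G side) (κ G side))) (gcdPairs-∣ _ u≢v))

  span⊆multiples : ∀ {x} → InSpanC G x → + μ ∣ dot s x
  span⊆multiples = span-least G (divisible-isSubmodule (+ μ) s) μ∣dot-rowN μ∣dot-rowNN

  μ-attained : ∃ λ y → InSpanC G y × dot s y ≡ + μ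
  μ-attained = gcd-closed
    (gcdFin-closed _ (λ v → rowN G v , rowN∈span G v , dot-rowN v))
    (gcdPairs-closed _ (λ u v → rowNN G u v , rowNN∈span G u v , dot-rowNN u v))
    where open IsIdeal (image-isIdeal (span-isSubmodule G) s)

  module _ (same : ∀ u v → side u ≡ side v → InSpanC G (e u ⊖ e v))
           (diff : ∀ u v → side u ≢ side v → InSpanC G (e u ⊕ e v)) where

    open IsSubmodule (span-isSubmodule G)

    e-minus-signed-e∈span : ∀ b w → InSpanC G (λ w′ → e w w′ - s w * s b * e b w′)
    e-minus-signed-e∈span b w = by-cases (side w Bool.≟ side b)
      where
      by-cases : Dec (side w ≡ side b) → InSpanC G (λ w′ → e w w′ - s w * s b * e b w′)
      by-cases (yes same-side) = resp-≗ (λ w′ → cong (λ z → e w w′ - z) (begin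
        e b w′                    ≡⟨ ℤ.*-identityˡ (e b w′) ⟨
        1ℤ * e b w′               ≡⟨ cong (_* e b w′) (sideSign-≡ same-side) ⟨
        s w * s b * e b w′        ∎)) (same w b same-side)
        where open ≡-Reasoning
      by-cases (no diff-side) = resp-≗ (λ w′ → cong (_+_ (e w w′)) (begin
        e b w′                    ≡⟨ ℤ.neg-involutive (e b w′) ⟨
        - - e b w′                ≡⟨ cong -_ (ℤ.-1*i≡-i (e b w′)) ⟨
        - (-1ℤ * e b w′)          ≡⟨ cong (λ z → - (z * e b w′)) (sideSign-≢ diff-side) ⟨
        - (s w * s b * e b w′)    ∎)) (diff w b diff-side)
        where open ≡-Reasoning

    minus-concentrated∈span : ∀ b x → InSpanC G (λ w → x w - s b * dot s x * e b w)
    minus-concentrated∈span b x =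
      resp-≗ expand (linComb-closed x (λ w′ w → e w′ w - s w′ * s b * e b w) (e-minus-signed-e∈span b))
      where
      open ≡-Reasoning
      expand : ∀ w → sumFin (λ w′ → x w′ * (e w′ w - s w′ * s b * e b w)) ≡ x w - s b * dot s x * e b w
      expand w = begin
        sumFin (λ w′ → x w′ * (e w′ w - s w′ * s b * e b w))
          ≡⟨ sumFin-cong (λ w′ → split (x w′) (e w′ w) (s w′) (s b) (e b w)) ⟩
        sumFin (λ w′ → x w′ * e w′ w + - (s b * e b w) * (s w′ * x w′))
          ≡⟨ sumFin-+ (λ w′ → x w′ * e w′ w) (λ w′ → - (s b * e b w) * (s w′ * x w′)) ⟩
        sumFin (λ w′ → x w′ * e w′ w) + sumFin (λ w′ → - (s b * e b w) * (s w′ * x w′))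
          ≡⟨ cong₂ _+_ (sumFin-δ x w) (sumFin-*ˡ (- (s b * e b w)) (λ w′ → s w′ * x w′)) ⟩
        x w + - (s b * e b w) * dot s x
          ≡⟨ regroup (x w) (s b) (e b w) (dot s x) ⟩
        x w - s b * dot s x * e b w ∎
        where
        split : ∀ X E S T F → X * (E - S * T * F) ≡ X * E + - (T * F) * (S * X)
        split = solve-∀
        regroup : ∀ X T F D → X + - (T * F) * D ≡ X - T * D * F
        regroup = solve-∀

    concentrated∈span : ∀ b {y} → InSpanC G y → InSpanC G (λ w → dot s y * e b w)
    concentrated∈span b {y} y∈span =
      resp-≗ rescale (*-closed (s b) (⊖-closed y∈span (minus-concentrated∈span b y)))
      where
      open ≡-Reasoning
      rescale : ∀ w → s b * (y w - (y w - s b * dot s y * e b w)) ≡ dot s y * e b w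
      rescale w = begin
        s b * (y w - (y w - s b * dot s y * e b w))  ≡⟨ cancel (s b) (y w) (dot s y) (e b w) ⟩
        s b * s b * (dot s y * e b w)                ≡⟨ cong (_* (dot s y * e b w)) (sideSign-sq (side b)) ⟩
        1ℤ * (dot s y * e b w)                       ≡⟨ ℤ.*-identityˡ _ ⟩
        dot s y * e b w                              ∎
        where
        cancel : ∀ S Y D F → S * (Y - (Y - S * D * F)) ≡ S * S * (D * F)
        cancel = solve-∀

    μe∈span : ∀ b → InSpanC G (λ w → + μ * e b w)
    μe∈span b = let y , y∈span , dot≡μ = μ-attained in
                subst (λ a → InSpanC G (λ w → a * e b w)) dot≡μ (concentrated∈span b y∈span)

    -- Any vertex b will do: it is only where the φ-value of x gets concentrated.
    multiples⊆span : Fin m → ∀ {x} → + μ ∣ dot s x → InSpanC G x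
    multiples⊆span b {x} (divides q dot≡qμ) =
      resp-≗ recombine (⊕-closed (minus-concentrated∈span b x) (*-closed (s b * q) (μe∈span b)))
      where
      recombine : ∀ w → x w - s b * dot s x * e b w + s b * q * (+ μ * e b w) ≡ x w
      recombine w = trans (cong (λ z → x w - s b * z * e b w + s b * q * (+ μ * e b w)) dot≡qμ)
                          (cancel (x w) (s b) q (+ μ) (e b w))
        where
        cancel : ∀ X S Q M F → X - S * (Q * M) * F + S * Q * (M * F) ≡ X
        cancel = solve-∀

<⇒≢fromℕ : ∀ {n} {i j : Fin (suc n)} → i < j → i ≢ fromℕ n
<⇒≢fromℕ {n} {j = j} i<j refl = ℕ.<-irrefl refl (ℕ.<-≤-trans i<j (Fin.≤fromℕ j))

module HermiteNormalForm {n} (k : ℕ) (t : Vecℤ (suc n))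
                         (t-last-unit : t (fromℕ n) * t (fromℕ n) ≡ 1ℤ) where

  last : Fin (suc n)
  last = fromℕ n

  μ : ℕ
  μ = suc k

  -- c i ≡ - t i * t last (mod μ), so each row of H lies in the lattice; as t last is a unit,
  -- c last = μ - 1 and the last row is μ e_last.
  c : Vecℤ (suc n)
  c i = + ((- (t i * t last)) %ℕ μ)

  H : Fin (suc n) → Fin (suc n) → ℤ
  H i j = e i j + c i * e last j

  c-bounds : ∀ i → (0ℤ ℤ.≤ c i) × (c i ℤ.< + μ)
  c-bounds i = +≤+ z≤n , +<+ (n%ℕd<d (- (t i * t last)) μ)

  μ∣c+t·t-last : ∀ i → + μ ∣ c i + t i * t last
  μ∣c+t·t-last i = divides (- q) (begin
    c i + a              ≡⟨ cong (_+_ (c i)) (ℤ.neg-involutive a) ⟨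
    c i + - - a          ≡⟨ cong (λ z → c i + - z) (a≡a%ℕn+[a/ℕn]*n (- a) μ) ⟩
    c i + - (c i + q * + μ) ≡⟨ cancel (c i) q (+ μ) ⟩
    - q * + μ            ∎)
    where
    open ≡-Reasoning
    a = t i * t last
    q = (- a) /ℕ μ
    cancel : ∀ C Q M → C + - (C + Q * M) ≡ - Q * M
    cancel = solve-∀

  c-last : c last ≡ + k
  c-last = trans (cong (λ z → + ((- z) %ℕ μ)) t-last-unit) (-1%ℕ k)
    where
    -1%ℕ : ∀ k → + (-1ℤ %ℕ suc k) ≡ + k
    -1%ℕ zero    = refl
    -1%ℕ (suc k) = refl

  H-last : ∀ j → H last j ≡ + μ * e last j
  H-last j = trans (factor (e last j) (c last)) (cong (λ z → (1ℤ + z) * e last j) c-last)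
    where
    factor : ∀ E C → E + C * E ≡ (1ℤ + C) * E
    factor = solve-∀

  dot-H : ∀ i → dot t (H i) ≡ t i + c i * t last
  dot-H i = trans (dot-⊕ʳ t (e i) (λ j → c i * e last j))
                  (cong₂ _+_ (dot-eʳ t i) (trans (dot-*ʳ t (e last) (c i)) (cong (c i *_) (dot-eʳ t last))))

  μ∣dot-H : ∀ i → + μ ∣ dot t (H i)
  μ∣dot-H i = subst (+ μ ∣_) unit-multiple (∣n⇒∣m*n (t last) (μ∣c+t·t-last i))
    where
    open ≡-Reasoning
    unit-multiple : t last * (c i + t i * t last) ≡ dot t (H i)
    unit-multiple = begin
      t last * (c i + t i * t last)          ≡⟨ expand (t last) (c i) (t i) ⟩
      c i * t last + t i * (t last * t last) ≡⟨ cong (λ z → c i * t last + t i * z) t-last-unit ⟩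
      c i * t last + t i * 1ℤ                ≡⟨ swap (c i) (t last) (t i) ⟩
      t i + c i * t last                     ≡⟨ dot-H i ⟨
      dot t (H i)                            ∎
      where
      expand : ∀ L C T → L * (C + T * L) ≡ C * L + T * (L * L)
      expand = solve-∀
      swap : ∀ C L T → C * L + T * 1ℤ ≡ T + C * L
      swap = solve-∀

  rowSpan⊆multiples : ∀ {y} → InRowSpan H y → + μ ∣ dot t y
  rowSpan⊆multiples (a , y≗) = resp-≗ (sym ∘ y≗) (linComb-closed a H μ∣dot-H)
    where open IsSubmodule (divisible-isSubmodule (+ μ) t)

  H-combination : ∀ (a : Vecℤ (suc n)) j → sumFin (λ i → a i * H i j) ≡ a j + e last j * dot a c
  H-combination a j = begin
    sumFin (λ i → a i * H i j)
      ≡⟨ sumFin-cong (λ i → split (a i) (e i j) (c i) (e last j)) ⟩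
    sumFin (λ i → a i * e i j + e last j * (a i * c i))
      ≡⟨ sumFin-+ (λ i → a i * e i j) (λ i → e last j * (a i * c i)) ⟩
    sumFin (λ i → a i * e i j) + sumFin (λ i → e last j * (a i * c i))
      ≡⟨ cong₂ _+_ (sumFin-δ a j) (sumFin-*ˡ (e last j) (λ i → a i * c i)) ⟩
    a j + e last j * dot a c ∎
    where
    open ≡-Reasoning
    split : ∀ A E C F → A * (E + C * F) ≡ A * E + F * (A * C)
    split = solve-∀

  μ∣dot-c : ∀ {y} → + μ ∣ dot t y → + μ ∣ dot y c
  μ∣dot-c {y} μ∣ty = ∣m+n∣n⇒∣m (subst (+ μ ∣_) (sym shift) (dot-∣ y _ μ∣c+t·t-last))
                               (∣n⇒∣m*n (t last) (subst (+ μ ∣_) (dot-comm t y) μ∣ty))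
    where
    open ≡-Reasoning
    shift : dot y c + t last * dot y t ≡ dot y (λ i → c i + t i * t last)
    shift = begin
      dot y c + t last * dot y t
        ≡⟨ cong (_+_ (dot y c)) (sumFin-*ˡ (t last) (λ i → y i * t i)) ⟨
      dot y c + sumFin (λ i → t last * (y i * t i))
        ≡⟨ sumFin-+ (λ i → y i * c i) (λ i → t last * (y i * t i)) ⟨
      sumFin (λ i → y i * c i + t last * (y i * t i))
        ≡⟨ sumFin-cong (λ i → collect (y i) (c i) (t i) (t last)) ⟩
      dot y (λ i → c i + t i * t last) ∎
      where
      collect : ∀ Y C T L → Y * C + L * (Y * T) ≡ Y * (C + T * L)
      collect = solve-∀

  multiples⊆rowSpan : ∀ {y} → + μ ∣ dot t y → InRowSpan H y
  multiples⊆rowSpan {y} μ∣ty = (λ i → y i - r * e i last) , λ j → sym (begin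
    sumFin (λ i → (y i - r * e i last) * H i j)
      ≡⟨ sumFin-cong (λ i → split (y i) r (e i last) (H i j)) ⟩
    sumFin (λ i → y i * H i j + - r * (H i j * e i last))
      ≡⟨ sumFin-+ (λ i → y i * H i j) (λ i → - r * (H i j * e i last)) ⟩
    sumFin (λ i → y i * H i j) + sumFin (λ i → - r * (H i j * e i last))
      ≡⟨ cong₂ _+_ (H-combination y j) (trans (sumFin-*ˡ (- r) (λ i → H i j * e i last))
                                              (cong (- r *_) (sumFin-δ (λ i → H i j) last))) ⟩
    y j + e last j * dot y c + - r * H last j
      ≡⟨ cong₂ (λ z w → y j + e last j * z + - r * w) yc≡rμ (H-last j) ⟩
    y j + e last j * (r * + μ) + - r * (+ μ * e last j)
      ≡⟨ cancel (y j) (e last j) r (+ μ) ⟩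
    y j ∎)
    where
    open ≡-Reasoning
    open _∣_ (μ∣dot-c {y} μ∣ty) renaming (quotient to r; equality to yc≡rμ)
    split : ∀ Y R E F → (Y - R * E) * F ≡ Y * F + - R * (F * E)
    split = solve-∀
    cancel : ∀ Y E R M → Y + E * (R * M) + - R * (M * E) ≡ Y
    cancel = solve-∀

  H-off-diagonal : ∀ {i j} → i ≢ j → j ≢ last → H i j ≡ 0ℤ
  H-off-diagonal {i} {j} i≢j j≢last = begin
    e i j + c i * e last j  ≡⟨ cong₂ (λ a b → a + c i * b) (e-≢ i≢j) (e-≢ (j≢last ∘ sym)) ⟩
    0ℤ + c i * 0ℤ           ≡⟨ ℤ.+-identityˡ (c i * 0ℤ) ⟩
    c i * 0ℤ                ≡⟨ ℤ.*-zeroʳ (c i) ⟩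
    0ℤ                      ∎
    where open ≡-Reasoning

  H-lower : ∀ {i j} → j < i → H i j ≡ 0ℤ
  H-lower j<i = H-off-diagonal (Fin.<⇒≢ j<i ∘ sym) (<⇒≢fromℕ j<i)

  H-diag-last : H last last ≡ + μ
  H-diag-last = trans (H-last last) (trans (cong (+ μ *_) (e-≡ refl)) (ℤ.*-identityʳ (+ μ)))

  H-diag-other : ∀ {i} → i ≢ last → H i i ≡ 1ℤ
  H-diag-other {i} i≢last = trans (cong₂ (λ a b → a + c i * b) (e-≡ {a = i} refl) (e-≢ (i≢last ∘ sym)))
                                  (cong (_+_ 1ℤ) (ℤ.*-zeroʳ (c i)))

  H-above-last : ∀ {i} → i ≢ last → H i last ≡ c i
  H-above-last {i} i≢last = trans (cong₂ (λ a b → a + c i * b) (e-≢ i≢last) (e-≡ refl))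
                                  (trans (ℤ.+-identityˡ (c i * 1ℤ)) (ℤ.*-identityʳ (c i)))

  H-diag-pos : ∀ i → 0ℤ ℤ.< H i i
  H-diag-pos i with i ≟ last
  ... | yes refl    = subst (0ℤ ℤ.<_) (sym H-diag-last) (+<+ (s≤s z≤n))
  ... | no i≢last   = subst (0ℤ ℤ.<_) (sym (H-diag-other i≢last)) (+<+ (s≤s z≤n))

  H-upper-reduced : ∀ {i j} → i < j → (0ℤ ℤ.≤ H i j) × (H i j ℤ.< H j j)
  H-upper-reduced {i} {j} i<j with j ≟ last
  ... | yes refl  = subst₂ (λ a d → (0ℤ ℤ.≤ a) × (a ℤ.< d))
                           (sym (H-above-last (<⇒≢fromℕ i<j))) (sym H-diag-last) (c-bounds i)
  ... | no j≢last = subst₂ (λ a d → (0ℤ ℤ.≤ a) × (a ℤ.< d))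
                           (sym (H-off-diagonal (Fin.<⇒≢ i<j) j≢last)) (sym (H-diag-other j≢last))
                           (+≤+ z≤n , +<+ (s≤s z≤n))

  H-diagOnesThen : DiagOnesThen H μ
  H-diagOnesThen i =
      (λ i-last → subst (λ j → H j j ≡ + μ) (sym (≡last (ℕ.suc-injective i-last))) H-diag-last)
    , (λ i-not-last → H-diag-other (λ i≡last → i-not-last (cong suc (toℕ≡n i≡last))))
    where
    ≡last : toℕ i ≡ n → i ≡ last
    ≡last toℕi≡n = Fin.toℕ-injective (trans toℕi≡n (sym (Fin.toℕ-fromℕ n)))
    toℕ≡n : i ≡ last → toℕ i ≡ n
    toℕ≡n i≡last = trans (cong toℕ i≡last) (Fin.toℕ-fromℕ n)

module _ {n} (G : Graph (suc n)) (side : Fin (suc n) → Bool)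
         (same : ∀ u v → side u ≡ side v → InSpanC G (e u ⊖ e v))
         (diff : ∀ u v → side u ≢ side v → InSpanC G (e u ⊕ e v))
         (k : ℕ) (μ≡ : gcd (δ G side) (κ G side) ≡ suc k) where

  open SignedSpan G side using (s; span⊆multiples; multiples⊆span)

  span⇒multiple : ∀ {x} → InSpanC G x → + suc k ∣ dot s x
  span⇒multiple {x} x∈span = subst (λ μ → + μ ∣ dot s x) μ≡ (span⊆multiples x∈span)

  multiple⇒span : ∀ {x} → + suc k ∣ dot s x → InSpanC G x
  multiple⇒span {x} k∣sx =
    multiples⊆span same diff (fromℕ n) (subst (λ μ → + μ ∣ dot s x) (sym μ≡) k∣sx)

  module Reordered (σ : Permutation′ (suc n)) where

    open HermiteNormalForm k (s ∘ (σ ⟨$⟩ʳ_)) (sideSign-sq (side (σ ⟨$⟩ʳ fromℕ n))) public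

    InReorderedSpan : Vecℤ (suc n) → Set
    InReorderedSpan y = Σ (Vecℤ (suc n)) λ x → InSpanC G x × (∀ j → y j ≡ x (σ ⟨$⟩ʳ j))

    rowSpan⇒reorderedSpan : ∀ {y} → InRowSpan H y → InReorderedSpan y
    rowSpan⇒reorderedSpan {y} y∈rowSpan =
        y ∘ (σ ⟨$⟩ˡ_)
      , multiple⇒span (subst (+ μ ∣_) reindex (rowSpan⊆multiples y∈rowSpan))
      , λ j → cong y (sym (inverseˡ σ {j}))
      where
      reindex : dot (s ∘ (σ ⟨$⟩ʳ_)) y ≡ dot s (y ∘ (σ ⟨$⟩ˡ_))
      reindex = sym (trans (dot-permute σ s (y ∘ (σ ⟨$⟩ˡ_)))
                           (dot-congʳ (s ∘ (σ ⟨$⟩ʳ_)) (λ j → cong y (inverseˡ σ {j}))))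

    reorderedSpan⇒rowSpan : ∀ {y} → InReorderedSpan y → InRowSpan H y
    reorderedSpan⇒rowSpan {y} (x , x∈span , y≗x∘σ) =
      multiples⊆rowSpan (subst (+ μ ∣_) reindex (span⇒multiple x∈span))
      where
      reindex : dot s x ≡ dot (s ∘ (σ ⟨$⟩ʳ_)) y
      reindex = trans (dot-permute σ s x) (dot-congʳ (s ∘ (σ ⟨$⟩ʳ_)) (sym ∘ y≗x∘σ))

    isHNF : IsHNF G σ H
    isHNF = (λ _ _ → H-lower) , H-diag-pos , (λ _ _ → H-upper-reduced)
          , λ y → rowSpan⇒reorderedSpan , reorderedSpan⇒rowSpan

  isRA : IsRA G (suc k)
  isRA = s≤s z≤n , λ σ → Reordered.H σ , Reordered.isHNF σ , Reordered.H-diagOnesThen σ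

mainTheorem17 : ∀ {m : ℕ} (G : Graph m) (side : Fin m → Bool) →
    Neighborly G →
    (∀ u v → side u ≡ side v → InSpanC G (e u ⊖ e v)) →
    (∀ u v → side u ≢ side v → InSpanC G (e u ⊕ e v)) →
    ¬ (δ G side ≡ 0 × κ G side ≡ 0) →
    IsRA G (gcd (δ G side) (κ G side))
mainTheorem17 {zero}  G side _ same diff not-both-zero = ⊥-elim (not-both-zero (refl , refl))
mainTheorem17 {suc n} G side _ same diff not-both-zero = by-cases _ refl
  where
  by-cases : ∀ μ → gcd (δ G side) (κ G side) ≡ μ → IsRA G (gcd (δ G side) (κ G side))
  by-cases zero    μ≡0 =
    ⊥-elim (not-both-zero (gcd[m,n]≡0⇒m≡0 μ≡0 , gcd[m,n]≡0⇒n≡0 (δ G side) μ≡0))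
  by-cases (suc k) μ≡  = subst (IsRA G) (sym μ≡) (isRA G side same diff k μ≡)
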